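{- The graph $K_6-e$ (the complete graph on $6$ vertices with one edge removed) is not an induced subgraph of $\mathcal{B}_k(G)$ for any finite simple graph $G$ and any positive integer $k$. Hence, for every $n\ge 6$, the graph $K_n-e$ is not an induced subgraph of any Bell coloring graph.
   Context: All graphs are finite and simple. A stable $k$-partition of a graph $G$ is a multiset $P=\{V_1,\dots,V_k\}$ of $k$ independent sets of $G$ (some possibly empty) that partition $V(G)$. For $v\in V(G)$, $P-v$ denotes the multiset $\{V_i\setminus\{v\}:1\le i\le k\}$. The Bell $k$-coloring graph $\mathcal{B}_k(G)$ has as vertices all stable $k$-partitions of $G$, and two distinct partitions $P,Q$ are adjacent if and only if $P-v=Q-v$ for some $v\in V(G)$. A Bell coloring graph is any graph of the form $\mathcal{B}_k(G)$. -}

module Defs where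

open import Data.Nat using (ℕ; zero; suc; _≤_)
open import Data.Fin using (Fin; zero; suc)
open import Data.Fin.Subset using (Subset; _∈_; outside)
open import Data.Vec using (Vec; lookup; map; toList; _[_]≔_)
open import Data.List.Relation.Binary.Permutation.Propositional using (_↭_)
open import Data.Product using (Σ; _×_; ∃)
open import Relation.Binary.PropositionalEquality using (_≡_; _≢_)
open import Relation.Nullary using (¬_)

record Graph (n : ℕ) : Set₁ where
  field
    Adj   : Fin n → Fin n → Set
    sym   : ∀ {u v} → Adj u v → Adj v u
    irrefl : ∀ {v} → ¬ Adj v v
open Graph public

Independent : ∀ {n} → Graph n → Subset n → Set
Independent G S = ∀ u v → u ∈ S → v ∈ S → ¬ Adj G u v

-- A stable k-partition: k independent sets (indexed by Fin k, possibly empty)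
-- such that every vertex lies in exactly one of them.
-- It is regarded as a multiset: two such are equal iff their lists of parts
-- are permutations of each other (see _≈P_).
record StablePartition {n} (G : Graph n) (k : ℕ) : Set₁ where
  field
    parts : Vec (Subset n) k
    indep : ∀ i → Independent G (lookup parts i)
    cover : ∀ v → Σ (Fin k) λ i → (v ∈ lookup parts i) × (∀ j → v ∈ lookup parts j → j ≡ i)
open StablePartition public

_≈P_ : ∀ {n} {G : Graph n} {k} → StablePartition G k → StablePartition G k → Set
P ≈P Q = toList (parts P) ↭ toList (parts Q)

removeV : ∀ {n} → Fin n → Subset n → Subset n
removeV v S = S [ v ]≔ outside

_minus_ : ∀ {n} {G : Graph n} {k} → StablePartition G k → Fin n → Vec (Subset n) k
P minus v = map (removeV v) (parts P)

BellAdj : ∀ {n} (G : Graph n) (k : ℕ) → StablePartition G k → StablePartition G k → Set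
BellAdj G k P Q = ¬ (P ≈P Q) × ∃ λ v → toList (P minus v) ↭ toList (Q minus v)

KminusE-Adj : ∀ {m} → Fin (suc (suc m)) → Fin (suc (suc m)) → Set
KminusE-Adj i j = i ≢ j × ¬ (i ≡ zero × j ≡ suc zero) × ¬ (i ≡ suc zero × j ≡ zero)

KminusEInducedIn : (m : ℕ) → ∀ {n} → Graph n → ℕ → Set₁
KminusEInducedIn m G k =
  Σ (Fin (suc (suc m)) → StablePartition G k) λ f →
    (∀ i j → i ≢ j → ¬ (f i ≈P f j)) ×
    (∀ i j → (KminusE-Adj i j → BellAdj G k (f i) (f j)) × (BellAdj G k (f i) (f j) → KminusE-Adj i j))

{-# OPTIONS --safe #-}

-- Two stable partitions are adjacent in 𝓑ₖ(G) exactly when they are distinct and their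
-- same-block relations agree on V(G) ∖ {v} for some v (a stable partition, as a multiset
-- of k blocks, is determined by its same-block relation, also after deleting a vertex).
-- So if X ⊕ Y denotes the set of pairs on which the relations of X and Y differ, adjacency
-- means that X ⊕ Y is a nonempty star. Let a, b be the nonadjacent vertices of K₆ − e and
-- c₀, …, c₃ the others. Then D = a ⊕ b is not a star, yet D = Eᵢ ⊕ Fᵢ for the stars
-- Eᵢ = a ⊕ cᵢ and Fᵢ = b ⊕ cᵢ, and the Eᵢ (likewise the Fᵢ) are distinct and pairwise
-- differ by nonempty stars. An edge set that is not a star contains two disjoint edges or a
-- triangle. With disjoint edges xy and zw, all Eᵢ contain the same one, say xy, and all Fᵢ
-- the other; the Eᵢ then share a centre in {x, y} and the Fᵢ one in {z, w}, so the Eᵢ can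
-- only differ on the edge joining the two centres. With a triangle, each Eᵢ is the part of
-- D at one corner or its complement, and two of the four have the same corner, which makes
-- them equal or makes them differ by a set containing the whole triangle. Each case ends
-- with a pigeonhole count on the four indices, as does the proof of the shared centres.

module Submission where

open import Defs
open import Data.Nat using (ℕ; _≤_; s≤s; z≤n)
open import Data.Product using (_×_; ∃; ∃₂; _,_; proj₁; proj₂)
open import Relation.Nullary using (¬_; Dec; yes; no; does; ¬?)

import Data.Nat as ℕ
open import Data.Nat.Properties using (≤-refl) renaming (suc-injective to ℕ-suc-injective)
open import Data.Bool using (Bool; true; false; _xor_)
import Data.Bool as Bool
open import Data.Bool.Properties
  using (¬-not; not-injective; not-involutive; xor-same; xor-comm; xor-inverseˡ; xor-inverseʳ)
open import Data.Empty using (⊥; ⊥-elim)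
open import Data.Fin using (Fin; zero; suc; _≟_; inject≤)
open import Data.Fin.Properties
  using (any?; all?; ¬∀⟶∃¬; pigeonhole; <⇒≢; suc-injective; inject≤-injective)
open import Data.Fin.Subset using (Subset; _∈_; _⊆_; Nonempty; outside) renaming (⊥ to ∅)
open import Data.Fin.Subset.Properties using (⊆-antisym; Empty-unique; nonempty?) renaming (∉⊥ to ∉∅)
open import Data.List using (List; []; _∷_; length; _++_)
open import Data.List.Membership.Propositional using () renaming (_∈_ to _∈ₗ_)
open import Data.List.Membership.Propositional.Properties using (∈-∃++)
open import Data.List.Relation.Unary.Any using (here; there)
open import Data.List.Relation.Unary.All as All using (All; []; _∷_)
open import Data.List.Relation.Unary.AllPairs as AllPairs using (AllPairs; []; _∷_)
open import Data.List.Relation.Binary.Permutation.Propositional as ↭ using (_↭_; ↭-refl; ↭-sym; ↭-trans)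
open import Data.List.Relation.Binary.Permutation.Propositional.Properties
  using (All-resp-↭; ∈-resp-↭; shift; ↭-length)
open import Data.Sum using (_⊎_; inj₁; inj₂; [_,_])
open import Data.Unit using (⊤; tt)
open import Data.Vec using (Vec; lookup; map; toList)
open import Data.Vec.Properties
  using ([]=-injective; []=⇒lookup; lookup⇒[]=; lookup∘update′; []≔-minimal; []≔-updates;
         lookup-map; length-toList; map-id; tabulate∘lookup)
open import Data.Vec.Membership.Propositional.Properties
  using (∈-lookup; ∈-toList⁺; ∈-toList⁻) renaming (∈-map⁺ to ∈-vmap⁺)
import Data.Vec.Relation.Unary.All.Properties as VecAll
import Data.Vec.Relation.Unary.AllPairs as VecAllPairs
import Data.Vec.Relation.Unary.AllPairs.Properties as VecAllPairs
import Data.Vec.Relation.Unary.Any as VecAny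
import Data.Vec.Relation.Unary.Any.Properties as VecAny
open import Function using (_∘_; id; mk⇔)
open import Relation.Nullary.Decidable using (_×-dec_; dec-true; does-⇔)
open import Relation.Binary.PropositionalEquality as ≡
  using (_≡_; _≢_; refl; cong; cong₂; subst; subst₂; trans; ≢-sym)

xor-true⁻ : ∀ {a b} → a xor b ≡ true → (a ≡ true × b ≡ false) ⊎ (a ≡ false × b ≡ true)
xor-true⁻ {true}  {false} _ = inj₁ (refl , refl)
xor-true⁻ {false} {true}  _ = inj₂ (refl , refl)

xor-false⁻ : ∀ {a b} → a xor b ≡ false → a ≡ b
xor-false⁻ {true}  {true}  _ = refl
xor-false⁻ {false} {false} _ = refl

xor-cancel : ∀ a b c → (a xor b) xor (a xor c) ≡ b xor c
xor-cancel false b     c = refl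
xor-cancel true  false c = not-involutive c
xor-cancel true  true  c = refl

xor-cancelʳ : ∀ a b c → (a xor c) xor (b xor c) ≡ a xor b
xor-cancelʳ a b c = trans (cong₂ _xor_ (xor-comm a c) (xor-comm b c)) (xor-cancel c a b)

xor-exchange : ∀ a b c d → a xor b ≡ c xor d → a xor c ≡ b xor d
xor-exchange false b false d refl = ≡.sym (xor-same b)
xor-exchange false b true  d refl = ≡.sym (xor-inverseˡ d)
xor-exchange true  b false d refl = ≡.sym (xor-inverseʳ b)
xor-exchange true  b true  d eq   = trans (≡.sym (xor-same b)) (cong (b xor_) (not-injective eq))

collision : (f : Fin 4 → Fin 3) → ∃₂ λ i j → i ≢ j × f i ≡ f j
collision f with pigeonhole (s≤s (s≤s (s≤s (s≤s z≤n)))) f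
... | i , j , i<j , fi≡fj = i , j , <⇒≢ i<j , fi≡fj

pair-code : Fin 3 → Bool × Bool
pair-code zero             = false , false
pair-code (suc zero)       = true  , false
pair-code (suc (suc zero)) = false , true

pair-code⁻¹ : ∀ a b → (a ≡ true → b ≡ false) → ∃ λ k → pair-code k ≡ (a , b)
pair-code⁻¹ false false _ = zero , refl
pair-code⁻¹ true  false _ = suc zero , refl
pair-code⁻¹ false true  _ = suc (suc zero) , refl
pair-code⁻¹ true  true  a⇒¬b with () ← a⇒¬b refl

pair-collision : (p q : Fin 4 → Bool) → (∀ i → p i ≡ true → q i ≡ false) →
                 ∃₂ λ i j → i ≢ j × (p i , q i) ≡ (p j , q j)
pair-collision p q p⇒¬q =
  let i , j , i≢j , same = collision (proj₁ ∘ coded)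
  in i , j , i≢j , trans (≡.sym (proj₂ (coded i))) (trans (cong pair-code same) (proj₂ (coded j)))
  where
    coded : ∀ i → ∃ λ k → pair-code k ≡ (p i , q i)
    coded i = pair-code⁻¹ (p i) (q i) (p⇒¬q i)

-- Edge sets and stars

record EdgeSet (n : ℕ) : Set where
  field
    adj        : Fin n → Fin n → Bool
    adj-sym    : ∀ s u → adj s u ≡ adj u s
    adj-irrefl : ∀ s → adj s s ≡ false
open EdgeSet

module _ {n : ℕ} where

  infix 4 _∋_─_ _≈_
  infixl 6 _⊕_

  record _∋_─_ (E : EdgeSet n) (s u : Fin n) : Set where
    constructor edge
    field present : adj E s u ≡ true
  open _∋_─_

  _⊕_ : EdgeSet n → EdgeSet n → EdgeSet n
  adj        (E ⊕ F) s u = adj E s u xor adj F s u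
  adj-sym    (E ⊕ F) s u = cong₂ _xor_ (adj-sym E s u) (adj-sym F s u)
  adj-irrefl (E ⊕ F) s   = cong₂ _xor_ (adj-irrefl E s) (adj-irrefl F s)

  record _≈_ (E F : EdgeSet n) : Set where
    constructor pointwise
    field same-adj : ∀ s u → adj E s u ≡ adj F s u
  open _≈_

  ≈-sym : ∀ {E F} → E ≈ F → F ≈ E
  ≈-sym E≈F = pointwise λ s u → ≡.sym (same-adj E≈F s u)

  ≈-trans : ∀ {E F G} → E ≈ F → F ≈ G → E ≈ G
  ≈-trans E≈F F≈G = pointwise λ s u → trans (same-adj E≈F s u) (same-adj F≈G s u)

  Edgeless : EdgeSet n → Set
  Edgeless E = ∀ s u → adj E s u ≡ false

  record Star (v : Fin n) (E : EdgeSet n) : Set where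
    constructor star
    field off-centre : ∀ s u → s ≢ v → u ≢ v → adj E s u ≡ false
  open Star

  IsStar : EdgeSet n → Set
  IsStar E = ∃ λ v → Star v E

  Isolated : Fin n → EdgeSet n → Set
  Isolated v E = ∀ u → adj E v u ≡ false

  Touches : Fin n → Fin n → Fin n → Set
  Touches s u v = v ≡ s ⊎ v ≡ u

  Apart : Fin n → Fin n → Fin n → Fin n → Set
  Apart x y z w = ∀ {v} → Touches x y v → Touches z w v → ⊥

  apart : ∀ {x y z w} → z ≢ x → z ≢ y → w ≢ x → w ≢ y → Apart x y z w
  apart z≢x _ _ _ (inj₁ refl) (inj₁ refl) = z≢x refl
  apart _ _ w≢x _ (inj₁ refl) (inj₂ refl) = w≢x refl
  apart _ z≢y _ _ (inj₂ refl) (inj₁ refl) = z≢y refl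
  apart _ _ _ w≢y (inj₂ refl) (inj₂ refl) = w≢y refl

  touches-≢ : ∀ {s u v c} → Touches s u v → c ≢ s → c ≢ u → c ≢ v
  touches-≢ (inj₁ refl) c≢s _ = c≢s
  touches-≢ (inj₂ refl) _ c≢u = c≢u

  edge-¬absent : ∀ {E s u} → E ∋ s ─ u → adj E s u ≡ false → ⊥
  edge-¬absent e f with () ← trans (≡.sym (present e)) f

  edge-sym : ∀ {E s u} → E ∋ s ─ u → E ∋ u ─ s
  edge-sym {E} {s} {u} e = edge (trans (adj-sym E u s) (present e))

  edge-irrefl : ∀ {E s u} → E ∋ s ─ u → s ≢ u
  edge-irrefl {E} {s} e refl = edge-¬absent e (adj-irrefl E s)

  edge-resp : ∀ {E F s u} → E ≈ F → E ∋ s ─ u → F ∋ s ─ u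
  edge-resp {s = s} {u} E≈F e = edge (trans (≡.sym (same-adj E≈F s u)) (present e))

  ⊕-edgeˡ : ∀ {E F s u} → E ∋ s ─ u → adj F s u ≡ false → E ⊕ F ∋ s ─ u
  ⊕-edgeˡ e f = edge (cong₂ _xor_ (present e) f)

  ⊕-edgeʳ : ∀ {E F s u} → adj E s u ≡ false → F ∋ s ─ u → E ⊕ F ∋ s ─ u
  ⊕-edgeʳ f e = edge (cong₂ _xor_ f (present e))

  ⊕-edge⁻ : ∀ {E F s u} → E ⊕ F ∋ s ─ u →
            (E ∋ s ─ u × adj F s u ≡ false) ⊎ (adj E s u ≡ false × F ∋ s ─ u)
  ⊕-edge⁻ e with xor-true⁻ (present e)
  ... | inj₁ (e₁ , f₂) = inj₁ (edge e₁ , f₂)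
  ... | inj₂ (f₁ , e₂) = inj₂ (f₁ , edge e₂)

  ⊕-comm : ∀ E F → E ⊕ F ≈ F ⊕ E
  ⊕-comm E F = pointwise λ s u → xor-comm (adj E s u) (adj F s u)

  ⊕-comm-≈ : ∀ {E F D} → E ⊕ F ≈ D → F ⊕ E ≈ D
  ⊕-comm-≈ {E} {F} eq = ≈-trans (⊕-comm F E) eq

  ≈⇒⊕-edgeless : ∀ {E F} → E ≈ F → Edgeless (E ⊕ F)
  ≈⇒⊕-edgeless {E} {F} E≈F s u =
    trans (cong (_xor adj F s u) (same-adj E≈F s u)) (xor-same (adj F s u))

  edgeless-resp : ∀ {E F} → E ≈ F → Edgeless E → Edgeless F
  edgeless-resp E≈F edgeless s u = trans (≡.sym (same-adj E≈F s u)) (edgeless s u)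

  star-resp : ∀ {v E F} → E ≈ F → Star v E → Star v F
  star-resp E≈F (star off) =
    star λ s u s≢v u≢v → trans (≡.sym (same-adj E≈F s u)) (off s u s≢v u≢v)

  isStar-resp : ∀ {E F} → E ≈ F → IsStar E → IsStar F
  isStar-resp E≈F (v , st) = v , star-resp E≈F st

  ⊕-star : ∀ {v E F} → Star v E → Star v F → Star v (E ⊕ F)
  ⊕-star (star offE) (star offF) =
    star λ s u s≢v u≢v → cong₂ _xor_ (offE s u s≢v u≢v) (offF s u s≢v u≢v)

  star-isolated-edgeless : ∀ {v E} → Star v E → Isolated v E → Edgeless E
  star-isolated-edgeless {v} {E} (star off) isolated s u with s ≟ v | u ≟ v
  ... | yes refl | _        = isolated u
  ... | no _     | yes refl = trans (adj-sym E s v) (isolated s)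
  ... | no s≢v   | no u≢v   = off s u s≢v u≢v

  star-touches : ∀ {v E s u} → Star v E → E ∋ s ─ u → Touches s u v
  star-touches {v} {s = s} {u} (star off) e with v ≟ s | v ≟ u
  ... | yes v≡s | _       = inj₁ v≡s
  ... | no _    | yes v≡u = inj₂ v≡u
  ... | no v≢s  | no v≢u  = ⊥-elim (edge-¬absent e (off s u (≢-sym v≢s) (≢-sym v≢u)))

  star-at-endpoint : ∀ {v E x y} → Star v E → E ∋ x ─ y → Star x E ⊎ Star y E
  star-at-endpoint st e with star-touches st e
  ... | inj₁ refl = inj₁ st
  ... | inj₂ refl = inj₂ st

  star-¬apart : ∀ {v E x y z w} → Star v E → E ∋ x ─ y → E ∋ z ─ w → ¬ Apart x y z w
  star-¬apart st e₁ e₂ ap = ap (star-touches st e₁) (star-touches st e₂)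

  star-¬triangle : ∀ {v E x y z} → Star v E → E ∋ x ─ y → E ∋ x ─ z → ¬ E ∋ y ─ z
  star-¬triangle st xy xz yz with star-touches st xy | star-touches st xz | star-touches st yz
  ... | inj₁ refl | _         | inj₁ refl = edge-irrefl xy refl
  ... | inj₁ refl | _         | inj₂ refl = edge-irrefl xz refl
  ... | inj₂ refl | inj₁ refl | _         = edge-irrefl xy refl
  ... | inj₂ refl | inj₂ refl | _         = edge-irrefl yz refl

  two-centres-edgeless : ∀ {v w E} → Star v E → Star w E → v ≢ w → adj E v w ≡ false → Edgeless E
  two-centres-edgeless {v} {w} {E} (star offv) (star offw) v≢w vw s u with s ≟ v | u ≟ v | s ≟ w | u ≟ w
  ... | no s≢v   | no u≢v   | _        | _        = offv s u s≢v u≢v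
  ... | _        | _        | no s≢w   | no u≢w   = offw s u s≢w u≢w
  ... | yes refl | _        | yes refl | _        = ⊥-elim (v≢w refl)
  ... | _        | yes refl | _        | yes refl = ⊥-elim (v≢w refl)
  ... | yes refl | _        | no _     | yes refl = vw
  ... | no _     | yes refl | yes refl | _        = trans (adj-sym E w v) vw

  AvoidingEdge : Fin n → EdgeSet n → Set
  AvoidingEdge v E = ∃₂ λ s u → s ≢ v × u ≢ v × E ∋ s ─ u

  avoiding-edge? : ∀ v E → Dec (AvoidingEdge v E)
  avoiding-edge? v E = any? λ s → any? λ u → ¬? (s ≟ v) ×-dec ¬? (u ≟ v) ×-dec edge? s u
    where
      edge? : ∀ s u → Dec (E ∋ s ─ u)
      edge? s u with adj E s u Bool.≟ true
      ... | yes e = yes (edge e)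
      ... | no ¬e = no (¬e ∘ present)

  ¬avoiding-edge⇒star : ∀ {v E} → ¬ AvoidingEdge v E → Star v E
  ¬avoiding-edge⇒star none = star λ s u s≢v u≢v → ¬-not λ e → none (s , u , s≢v , u≢v , edge e)

  star? : ∀ v E → Dec (Star v E)
  star? v E with avoiding-edge? v E
  ... | yes (s , u , s≢v , u≢v , e) = no λ st → edge-¬absent e (off-centre st s u s≢v u≢v)
  ... | no none                     = yes (¬avoiding-edge⇒star none)

  ¬star⇒avoiding-edge : ∀ {v E} → ¬ Star v E → AvoidingEdge v E
  ¬star⇒avoiding-edge {v} {E} ¬star with avoiding-edge? v E
  ... | yes e   = e
  ... | no none = ⊥-elim (¬star (¬avoiding-edge⇒star none))

  edge-avoiding⁻ : ∀ {E x y s u} → E ∋ s ─ u → s ≢ x → u ≢ x →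
                   (s ≢ y × u ≢ y) ⊎ ∃ λ t → t ≢ x × E ∋ y ─ t
  edge-avoiding⁻ {y = y} {s} {u} e s≢x u≢x with s ≟ y | u ≟ y
  ... | yes refl | _        = inj₂ (u , u≢x , e)
  ... | no _     | yes refl = inj₂ (s , s≢x , edge-sym e)
  ... | no s≢y   | no u≢y   = inj₁ (s≢y , u≢y)

  _≐_ : Fin n × Fin n → Fin n × Fin n → Set
  (s , u) ≐ (a , b) = (s ≡ a × u ≡ b) ⊎ (s ≡ b × u ≡ a)

  ≐-swap : ∀ {s u a b} → (s , u) ≐ (a , b) → (s , u) ≐ (b , a)
  ≐-swap (inj₁ p) = inj₂ p
  ≐-swap (inj₂ p) = inj₁ p

  ≐-agree : ∀ E F {s u a b} → (s , u) ≐ (a , b) → adj E a b ≡ adj F a b → adj E s u ≡ adj F s u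
  ≐-agree E F (inj₁ (refl , refl)) eq = eq
  ≐-agree E F {a = a} {b} (inj₂ (refl , refl)) eq = trans (adj-sym E b a) (trans eq (adj-sym F a b))

  edge-at-centre : ∀ {v E s u} → Star v E → E ∋ s ─ u → ∃ λ w → E ∋ v ─ w × (s , u) ≐ (v , w)
  edge-at-centre {s = s} {u} st e with star-touches st e
  ... | inj₁ refl = u , e , inj₁ (refl , refl)
  ... | inj₂ refl = s , edge-sym e , inj₂ (refl , refl)

  ≈-from-support : ∀ {E F} (S : Fin n → Fin n → Set) →
                   (∀ {s u} → E ∋ s ─ u → S s u) → (∀ {s u} → F ∋ s ─ u → S s u) →
                   (∀ {s u} → S s u → adj E s u ≡ adj F s u) → E ≈ F
  ≈-from-support {E} {F} S suppE suppF agree = pointwise same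
    where
      same : ∀ s u → adj E s u ≡ adj F s u
      same s u with adj E s u in eE
      ... | true = trans (≡.sym eE) (agree (suppE (edge eE)))
      ... | false with adj F s u in eF
      ...   | true  = trans (≡.sym eE) (trans (agree (suppF (edge eF))) eF)
      ...   | false = refl

  centre-edge-avoiding : ∀ {x y X} → Star y X → ¬ Star x X → ∃ λ t → t ≢ x × X ∋ y ─ t
  centre-edge-avoiding sty ¬stx with ¬star⇒avoiding-edge ¬stx
  ... | s , u , s≢x , u≢x , e with edge-avoiding⁻ e s≢x u≢x
  ...   | inj₁ (s≢y , u≢y) = ⊥-elim (edge-¬absent e (off-centre sty s u s≢y u≢y))
  ...   | inj₂ yt          = yt

  -- X ⊕ Y contains both y─t and x─u, and two edges of a star meet.
  forced-endpoint : ∀ {x y t u X Y} → x ≢ y → t ≢ x → Star x X → Star y Y → Y ∋ y ─ t →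
                    IsStar (X ⊕ Y) → X ∋ x ─ u → u ≢ y → u ≡ t
  forced-endpoint {x} {y} {t} {u} x≢y t≢x (star offX) (star offY) yt (_ , st) xu u≢y with u ≟ t
  ... | yes u≡t = u≡t
  ... | no u≢t  = ⊥-elim (star-¬apart st (⊕-edgeʳ (offX y t (≢-sym x≢y) t≢x) yt)
                                         (⊕-edgeˡ xu (offY x u x≢y u≢y))
                                         (apart x≢y (≢-sym t≢x) u≢y u≢t))

  record DisjointEdges (D : EdgeSet n) : Set where
    constructor disjoint-edges
    field
      {x y z w} : Fin n
      xy        : D ∋ x ─ y
      zw        : D ∋ z ─ w
      apart-xy-zw : Apart x y z w

  record Triangle (D : EdgeSet n) : Set where
    constructor triangle
    field
      {x y z} : Fin n
      xy      : D ∋ x ─ y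
      xz      : D ∋ x ─ z
      yz      : D ∋ y ─ z

  -- The vertex v₀ is needed: on an empty vertex set ¬ IsStar D holds vacuously.
  nonstar-shape : ∀ {D} → Fin n → ¬ IsStar D → DisjointEdges D ⊎ Triangle D
  nonstar-shape {D} v₀ ¬star with ¬star⇒avoiding-edge (¬star ∘ (v₀ ,_))
  ... | x , y , _ , _ , xy
      with ¬star⇒avoiding-edge (¬star ∘ (x ,_)) | ¬star⇒avoiding-edge (¬star ∘ (y ,_))
  ... | s , u , s≢x , u≢x , su | s′ , u′ , s′≢y , u′≢y , su′
      with edge-avoiding⁻ {y = y} su s≢x u≢x | edge-avoiding⁻ {y = x} su′ s′≢y u′≢y
  ... | inj₁ (s≢y , u≢y) | _ = inj₁ (disjoint-edges xy su (apart s≢x s≢y u≢x u≢y))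
  ... | _ | inj₁ (s′≢x , u′≢x) = inj₁ (disjoint-edges xy su′ (apart s′≢x s′≢y u′≢x u′≢y))
  ... | inj₂ (t , t≢x , yt) | inj₂ (t′ , t′≢y , xt′) with t ≟ t′
  ...   | yes refl = inj₂ (triangle xy xt′ yt)
  ...   | no t≢t′  =
    inj₁ (disjoint-edges xt′ yt (apart (≢-sym (edge-irrefl xy)) (≢-sym t′≢y) t≢x t≢t′))

  -- Four stars pairwise differing by nonempty stars

  record StarFamily (E : Fin 4 → EdgeSet n) : Set where
    field
      member-star   : ∀ i → IsStar (E i)
      pair-star     : ∀ {i j} → i ≢ j → IsStar (E i ⊕ E j)
      pair-nonempty : ∀ {i j} → i ≢ j → ¬ Edgeless (E i ⊕ E j)
  open StarFamily

  module CommonCentre {E : Fin 4 → EdgeSet n} (fam : StarFamily E) {x y : Fin n}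
                      (xy∈E : ∀ i → E i ∋ x ─ y) where

    x≢y : x ≢ y
    x≢y = edge-irrefl (xy∈E zero)

    centred : ∀ i → Star x (E i) ⊎ Star y (E i)
    centred i = star-at-endpoint (proj₂ (member-star fam i)) (xy∈E i)

    pair-star′ : ∀ i j → IsStar (E i ⊕ E j)
    pair-star′ i j with i ≟ j
    ... | yes refl = x , star λ s u _ _ → xor-same (adj (E i) s u)
    ... | no i≢j   = pair-star fam i≢j

    -- Each E m is then x─y together with at most one of x─t and y─t: three candidates for
    -- four distinct sets.
    module SplitCentres {i j t} (Ei-y : Star y (E i)) (yt : E i ∋ y ─ t)
                         (Ej-x : Star x (E j)) (xt : E j ∋ x ─ t) where

      t≢x : t ≢ x
      t≢x = ≢-sym (edge-irrefl xt)

      t≢y : t ≢ y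
      t≢y = ≢-sym (edge-irrefl yt)

      OnTriangle : Fin n → Fin n → Set
      OnTriangle s u = (s , u) ≐ (x , y) ⊎ (s , u) ≐ (x , t) ⊎ (s , u) ≐ (y , t)

      on-triangle : ∀ m {s u} → E m ∋ s ─ u → OnTriangle s u
      on-triangle m e with centred m
      ... | inj₁ Em-x with edge-at-centre Em-x e
      ...   | w , xw , su≐xw with w ≟ y
      ...     | yes refl = inj₁ su≐xw
      ...     | no w≢y
              with refl ← forced-endpoint x≢y t≢x Em-x Ei-y yt (pair-star′ m i) xw w≢y =
                inj₂ (inj₁ su≐xw)
      on-triangle m e | inj₂ Em-y with edge-at-centre Em-y e
      ...   | w , yw , su≐yw with w ≟ x
      ...     | yes refl = inj₁ (≐-swap su≐yw)
      ...     | no w≢x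
              with refl ← forced-endpoint (≢-sym x≢y) t≢y Em-y Ej-x xt (pair-star′ m j) yw w≢x =
                inj₂ (inj₂ su≐yw)

      not-both : ∀ m → E m ∋ x ─ t → ¬ E m ∋ y ─ t
      not-both m = star-¬triangle (proj₂ (member-star fam m)) (xy∈E m)

      impossible : ⊥
      impossible with pair-collision (λ m → adj (E m) x t) (λ m → adj (E m) y t)
                                     (λ m xt∈ → ¬-not λ yt∈ → not-both m (edge xt∈) (edge yt∈))
      ... | m , m′ , m≢m′ , same =
        pair-nonempty fam m≢m′ (≈⇒⊕-edgeless {E m} {E m′}
          (≈-from-support OnTriangle (on-triangle m) (on-triangle m′) agree))
        where
          agree : ∀ {s u} → OnTriangle s u → adj (E m) s u ≡ adj (E m′) s u
          agree (inj₁ p)        =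
            ≐-agree (E m) (E m′) p (trans (present (xy∈E m)) (≡.sym (present (xy∈E m′))))
          agree (inj₂ (inj₁ p)) = ≐-agree (E m) (E m′) p (cong proj₁ same)
          agree (inj₂ (inj₂ p)) = ≐-agree (E m) (E m′) p (cong proj₂ same)

    mixed-centres : ∀ {i j} → ¬ Star x (E i) → ¬ Star y (E j) → ⊥
    mixed-centres {i} {j} ¬Ei-x ¬Ej-y
      with Ei-y ← [ ⊥-elim ∘ ¬Ei-x , id ] (centred i)
         | Ej-x ← [ id , ⊥-elim ∘ ¬Ej-y ] (centred j)
      with t , t≢x , yt ← centre-edge-avoiding Ei-y ¬Ei-x
         | t′ , t′≢y , xt′ ← centre-edge-avoiding Ej-x ¬Ej-y
      with refl ← forced-endpoint x≢y t≢x Ej-x Ei-y yt (pair-star′ j i) xt′ t′≢y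
      = SplitCentres.impossible Ei-y yt Ej-x xt′

    common-centre : ∃ λ v → Touches x y v × ∀ i → Star v (E i)
    common-centre with all? (λ i → star? x (E i)) | all? (λ i → star? y (E i))
    ... | yes all-x | _         = x , inj₁ refl , all-x
    ... | no _      | yes all-y = y , inj₂ refl , all-y
    ... | no ¬all-x | no ¬all-y =
      ⊥-elim (mixed-centres (proj₂ (¬∀⟶∃¬ 4 _ (λ i → star? x (E i)) ¬all-x))
                            (proj₂ (¬∀⟶∃¬ 4 _ (λ i → star? y (E i)) ¬all-y)))

  module _ {A B D : EdgeSet n} (A⊕B≈D : A ⊕ B ≈ D) where

    split : ∀ {s u} → D ∋ s ─ u →
            (A ∋ s ─ u × adj B s u ≡ false) ⊎ (adj A s u ≡ false × B ∋ s ─ u)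
    split e = ⊕-edge⁻ (edge-resp (≈-sym A⊕B≈D) e)

    presentˡ : ∀ {s u} → D ∋ s ─ u → adj B s u ≡ false → A ∋ s ─ u
    presentˡ e Bsu with split e
    ... | inj₁ (Asu , _) = Asu
    ... | inj₂ (_ , Bsu′) = ⊥-elim (edge-¬absent Bsu′ Bsu)

    absentˡ : ∀ {s u} → D ∋ s ─ u → B ∋ s ─ u → adj A s u ≡ false
    absentˡ e Bsu with split e
    ... | inj₁ (_ , Bsu′) = ⊥-elim (edge-¬absent Bsu Bsu′)
    ... | inj₂ (Asu , _) = Asu

    absentʳ : ∀ {s u} → D ∋ s ─ u → A ∋ s ─ u → adj B s u ≡ false
    absentʳ e Asu with split e
    ... | inj₁ (_ , Bsu) = Bsu
    ... | inj₂ (Asu′ , _) = ⊥-elim (edge-¬absent Asu Asu′)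

  ⊕-exchange : ∀ {A B A′ B′ D} → A ⊕ B ≈ D → A′ ⊕ B′ ≈ D → A ⊕ A′ ≈ B ⊕ B′
  ⊕-exchange {A} {B} {A′} {B′} eq eq′ = pointwise λ s u →
    xor-exchange (adj A s u) (adj B s u) (adj A′ s u) (adj B′ s u)
                 (trans (same-adj eq s u) (≡.sym (same-adj eq′ s u)))

  -- E i = a ⊕ c i and F i = b ⊕ c i, where D = a ⊕ b for the nonadjacent vertices a, b of
  -- K₆ − e and c i are its other vertices.
  record Config (D : EdgeSet n) : Set where
    field
      E F      : Fin 4 → EdgeSet n
      E-family : StarFamily E
      F-family : StarFamily F
      E⊕F≈D    : ∀ i → E i ⊕ F i ≈ D

  swap-config : ∀ {D} → Config D → Config D
  swap-config c = record
    { E = F ; F = E ; E-family = F-family ; F-family = E-family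
    ; E⊕F≈D = λ i → ⊕-comm-≈ (E⊕F≈D i) }
    where open Config c

  module _ {D : EdgeSet n} (c : Config D) where
    open Config c

    shared-centres : ∀ {v w} → (∀ i → Star v (E i)) → (∀ i → Star w (F i)) → v ≢ w → ⊥
    shared-centres {v} {w} E-v F-w v≢w
      with i , j , i≢j , same ← pair-collision (λ i → adj (E i) v w) (λ _ → false) (λ _ _ → refl)
      = pair-nonempty E-family i≢j
          (two-centres-edgeless (⊕-star (E-v i) (E-v j))
                                (star-resp (≈-sym (⊕-exchange (E⊕F≈D i) (E⊕F≈D j)))
                                           (⊕-star (F-w i) (F-w j)))
                                v≢w
                                (trans (cong (_xor adj (E j) v w) (cong proj₁ same)) (xor-same (adj (E j) v w))))

    one-side-impossible : ∀ {x y z w} → (∀ i → E i ∋ x ─ y) → (∀ i → F i ∋ z ─ w) →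
                          Apart x y z w → ⊥
    one-side-impossible xy∈E zw∈F ap
      with v , v∈xy , E-v ← CommonCentre.common-centre E-family xy∈E
         | v′ , v′∈zw , F-v′ ← CommonCentre.common-centre F-family zw∈F
      = shared-centres E-v F-v′ λ { refl → ap v∈xy v′∈zw }

  side : ∀ {A B D x y z w} → A ⊕ B ≈ D → IsStar A → IsStar B →
         D ∋ x ─ y → D ∋ z ─ w → Apart x y z w →
         (A ∋ x ─ y × B ∋ z ─ w) ⊎ (B ∋ x ─ y × A ∋ z ─ w)
  side eq (_ , stA) (_ , stB) xy zw ap with split eq xy | split eq zw
  ... | inj₁ (Axy , _) | inj₁ (Azw , _) = ⊥-elim (star-¬apart stA Axy Azw ap)
  ... | inj₁ (Axy , _) | inj₂ (_ , Bzw) = inj₁ (Axy , Bzw)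
  ... | inj₂ (_ , Bxy) | inj₁ (Azw , _) = inj₂ (Bxy , Azw)
  ... | inj₂ (_ , Bxy) | inj₂ (_ , Bzw) = ⊥-elim (star-¬apart stB Bxy Bzw ap)

  module _ {D : EdgeSet n} (c : Config D) {x y z w}
           (xy : D ∋ x ─ y) (zw : D ∋ z ─ w) (ap : Apart x y z w) where
    open Config c

    mixed-sides : ∀ {i j} → E i ∋ x ─ y → F i ∋ z ─ w → F j ∋ x ─ y → E j ∋ z ─ w → ⊥
    mixed-sides {i} {j} Eixy Fizw Fjxy Ejzw with i ≟ j
    ... | yes refl = edge-¬absent Eixy (absentˡ (E⊕F≈D i) xy Fjxy)
    ... | no i≢j   = star-¬apart (proj₂ (pair-star E-family i≢j))
                                 (⊕-edgeˡ Eixy (absentˡ (E⊕F≈D j) xy Fjxy))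
                                 (⊕-edgeʳ (absentˡ (E⊕F≈D i) zw Fizw) Ejzw) ap

    side-of : ∀ i → (E i ∋ x ─ y × F i ∋ z ─ w) ⊎ (F i ∋ x ─ y × E i ∋ z ─ w)
    side-of i = side (E⊕F≈D i) (member-star E-family i) (member-star F-family i) xy zw ap

  uniform-side : ∀ {D} (c : Config D) {x y z w} (xy : D ∋ x ─ y) (zw : D ∋ z ─ w) (ap : Apart x y z w) →
                 let open Config c in
                 (∀ i → E i ∋ x ─ y × F i ∋ z ─ w) ⊎ (∀ i → F i ∋ x ─ y × E i ∋ z ─ w)
  uniform-side c xy zw ap with side-of c xy zw ap zero
  ... | inj₁ (E₀xy , F₀zw) = inj₁ λ j →
    [ id , (λ (Fxy , Ezw) → ⊥-elim (mixed-sides c xy zw ap E₀xy F₀zw Fxy Ezw)) ] (side-of c xy zw ap j)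
  ... | inj₂ (F₀xy , E₀zw) = inj₂ λ j →
    [ (λ (Exy , Fzw) → ⊥-elim (mixed-sides (swap-config c) xy zw ap F₀xy E₀zw Exy Fzw)) , id ]
      (side-of c xy zw ap j)

  disjoint-edges-impossible : ∀ {D} → Config D → DisjointEdges D → ⊥
  disjoint-edges-impossible c (disjoint-edges xy zw ap) with uniform-side c xy zw ap
  ... | inj₁ sides = one-side-impossible c (proj₁ ∘ sides) (proj₂ ∘ sides) ap
  ... | inj₂ sides = one-side-impossible (swap-config c) (proj₁ ∘ sides) (proj₂ ∘ sides) ap

  -- Given A ⊕ B ≈ D, SplitAt v A B says that A consists of the edges of D at v.
  SplitAt : Fin n → EdgeSet n → EdgeSet n → Set
  SplitAt v A B = Star v A × Isolated v B

  apex-split : ∀ {A B D x y z} → A ⊕ B ≈ D → IsStar A → IsStar B →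
               D ∋ x ─ y → D ∋ x ─ z → A ∋ x ─ y → A ∋ x ─ z → B ∋ y ─ z → SplitAt x A B
  apex-split {A} {B} {D} {x} {y} {z} eq (_ , stA) (r , stB) Dxy Dxz Axy Axz Byz = A-x , isolated
    where
      A-x : Star x A
      A-x with star-touches stA Axy | star-touches stA Axz
      ... | inj₁ refl | _         = stA
      ... | inj₂ refl | inj₁ refl = stA
      ... | inj₂ refl | inj₂ refl = ⊥-elim (edge-irrefl Byz refl)

      r∈yz : Touches y z r
      r∈yz = star-touches stB Byz

      isolated : Isolated x B
      isolated u with u ≟ y | u ≟ z
      ... | yes refl | _        = absentʳ eq Dxy Axy
      ... | no _     | yes refl = absentʳ eq Dxz Axz
      ... | no u≢y   | no u≢z   = off-centre stB x u (touches-≢ r∈yz (edge-irrefl Axy) (edge-irrefl Axz))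
                                                     (touches-≢ r∈yz u≢y u≢z)

  rotate : ∀ {D} → Triangle D → Fin 3 → Triangle D
  rotate T                    zero             = T
  rotate (triangle xy xz yz) (suc zero)       = triangle (edge-sym xy) yz xz
  rotate (triangle xy xz yz) (suc (suc zero)) = triangle (edge-sym xz) (edge-sym yz) xy

  apex : ∀ {D} → Triangle D → Fin n
  apex = Triangle.x

  triangle-split : ∀ {A B D} → A ⊕ B ≈ D → IsStar A → IsStar B → (T : Triangle D) →
                   ∃ λ k → SplitAt (apex (rotate T k)) A B ⊎ SplitAt (apex (rotate T k)) B A
  triangle-split eq stA stB (triangle xy xz yz) with split eq xy | split eq xz | split eq yz
  ... | inj₁ (Axy , _) | inj₁ (Axz , _) | inj₁ (Ayz , _) = ⊥-elim (star-¬triangle (proj₂ stA) Axy Axz Ayz)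
  ... | inj₂ (_ , Bxy) | inj₂ (_ , Bxz) | inj₂ (_ , Byz) = ⊥-elim (star-¬triangle (proj₂ stB) Bxy Bxz Byz)
  ... | inj₁ (Axy , _) | inj₁ (Axz , _) | inj₂ (_ , Byz) =
    zero , inj₁ (apex-split eq stA stB xy xz Axy Axz Byz)
  ... | inj₂ (_ , Bxy) | inj₂ (_ , Bxz) | inj₁ (Ayz , _) =
    zero , inj₂ (apex-split (⊕-comm-≈ eq) stB stA xy xz Bxy Bxz Ayz)
  ... | inj₁ (Axy , _) | inj₂ (_ , Bxz) | inj₁ (Ayz , _) =
    suc zero , inj₁ (apex-split eq stA stB (edge-sym xy) yz (edge-sym Axy) Ayz Bxz)
  ... | inj₂ (_ , Bxy) | inj₁ (Axz , _) | inj₂ (_ , Byz) =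
    suc zero , inj₂ (apex-split (⊕-comm-≈ eq) stB stA (edge-sym xy) yz (edge-sym Bxy) Byz Axz)
  ... | inj₂ (_ , Bxy) | inj₁ (Axz , _) | inj₁ (Ayz , _) =
    suc (suc zero) , inj₁ (apex-split eq stA stB (edge-sym xz) (edge-sym yz) (edge-sym Axz) (edge-sym Ayz) Bxy)
  ... | inj₁ (Axy , _) | inj₂ (_ , Bxz) | inj₂ (_ , Byz) =
    suc (suc zero) , inj₂ (apex-split (⊕-comm-≈ eq) stB stA (edge-sym xz) (edge-sym yz)
                                      (edge-sym Bxz) (edge-sym Byz) Axy)

  module _ {D : EdgeSet n} (c : Config D) where
    open Config c

    same-split-edgeless : ∀ {v i j} → SplitAt v (E i) (F i) → SplitAt v (E j) (F j) → Edgeless (E i ⊕ E j)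
    same-split-edgeless {v} {i} {j} (Ei-v , Fi-iso) (Ej-v , Fj-iso) =
      star-isolated-edgeless (⊕-star Ei-v Ej-v) λ u →
        trans (same-adj (⊕-exchange (E⊕F≈D i) (E⊕F≈D j)) v u) (cong₂ _xor_ (Fi-iso u) (Fj-iso u))

    mixed-split-impossible : ∀ {i j} (T : Triangle D) →
      SplitAt (apex T) (E i) (F i) → SplitAt (apex T) (F j) (E j) → IsStar (E i ⊕ E j) → ⊥
    mixed-split-impossible {i} {j} (triangle {x} {y} {z} xy xz yz) (Ei-x , Fi-iso) (Fj-x , Ej-iso) (_ , st) =
      star-¬triangle st (from-x xy) (from-x xz)
        (⊕-edgeʳ (off-centre Ei-x y z y≢x z≢x) (presentˡ (E⊕F≈D j) yz (off-centre Fj-x y z y≢x z≢x)))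
      where
        y≢x : y ≢ x
        y≢x = ≢-sym (edge-irrefl xy)
        z≢x : z ≢ x
        z≢x = ≢-sym (edge-irrefl xz)
        from-x : ∀ {u} → D ∋ x ─ u → E i ⊕ E j ∋ x ─ u
        from-x {u} xu = ⊕-edgeˡ (presentˡ (E⊕F≈D i) xu (Fi-iso u)) (Ej-iso u)

  module _ {D : EdgeSet n} (c : Config D) (T : Triangle D) where
    open Config c

    CornerSplit : Fin 4 → Set
    CornerSplit i = ∃ λ k → SplitAt (apex (rotate T k)) (E i) (F i) ⊎ SplitAt (apex (rotate T k)) (F i) (E i)

    corner-split : ∀ i → CornerSplit i
    corner-split i = triangle-split (E⊕F≈D i) (member-star E-family i) (member-star F-family i) T

    same-corner-split-impossible : ∀ {i j} → i ≢ j → (κ : CornerSplit i) (κ′ : CornerSplit j) →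
                                   proj₁ κ ≡ proj₁ κ′ → ⊥
    same-corner-split-impossible i≢j (k , inj₁ si) (_ , inj₁ sj) refl =
      pair-nonempty E-family i≢j (same-split-edgeless c si sj)
    same-corner-split-impossible i≢j (k , inj₂ si) (_ , inj₂ sj) refl =
      pair-nonempty F-family i≢j (same-split-edgeless (swap-config c) si sj)
    same-corner-split-impossible i≢j (k , inj₁ si) (_ , inj₂ sj) refl =
      mixed-split-impossible c (rotate T k) si sj (pair-star E-family i≢j)
    same-corner-split-impossible i≢j (k , inj₂ si) (_ , inj₁ sj) refl =
      mixed-split-impossible c (rotate T k) sj si (pair-star E-family (≢-sym i≢j))

  triangle-impossible : ∀ {D} → Config D → Triangle D → ⊥
  triangle-impossible c T with i , j , i≢j , same ← collision (λ i → proj₁ (corner-split c T i)) =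
    same-corner-split-impossible c T i≢j (corner-split c T i) (corner-split c T j) same

  config-impossible : ∀ {D} → Config D → ¬ IsStar D → ⊥
  config-impossible c ¬star with nonstar-shape (proj₁ (member-star (Config.E-family c) zero)) ¬star
  ... | inj₁ de = disjoint-edges-impossible c de
  ... | inj₂ T  = triangle-impossible c T

-- Permutations of lists of disjoint blocks

AllPairs-resp-↭ : ∀ {A : Set} {R : A → A → Set} → (∀ {x y} → R x y → R y x) →
                  ∀ {xs ys} → xs ↭ ys → AllPairs R xs → AllPairs R ys
AllPairs-resp-↭ R-sym ↭.refl rs = rs
AllPairs-resp-↭ R-sym (↭.prep x σ) (rx ∷ rs) = All-resp-↭ σ rx ∷ AllPairs-resp-↭ R-sym σ rs
AllPairs-resp-↭ R-sym (↭.swap x y σ) ((rxy ∷ rx) ∷ (ry ∷ rs)) =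
  (R-sym rxy ∷ All-resp-↭ σ ry) ∷ (All-resp-↭ σ rx ∷ AllPairs-resp-↭ R-sym σ rs)
AllPairs-resp-↭ R-sym (↭.trans σ τ) rs = AllPairs-resp-↭ R-sym τ (AllPairs-resp-↭ R-sym σ rs)

AllPairs-toList⁺ : ∀ {A : Set} {R : A → A → Set} {m} {xs : Vec A m} →
                   VecAllPairs.AllPairs R xs → AllPairs R (toList xs)
AllPairs-toList⁺ VecAllPairs.[]         = []
AllPairs-toList⁺ (rx VecAllPairs.∷ rxs) = VecAll.toList⁺ rx ∷ AllPairs-toList⁺ rxs

module _ {A B : Set} (g : A → B) where

  ∈-toList-map⁺ : ∀ {m} (xs : Vec A m) i → g (lookup xs i) ∈ₗ toList (map g xs)
  ∈-toList-map⁺ xs i = ∈-toList⁺ (∈-vmap⁺ g (∈-lookup i xs))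

  ∈-toList-map⁻ : ∀ {m} {xs : Vec A m} {y} → y ∈ₗ toList (map g xs) → ∃ λ i → y ≡ g (lookup xs i)
  ∈-toList-map⁻ {xs = xs} y∈ with p ← ∈-toList⁻ y∈ =
    VecAny.index p , trans (VecAny.lookup-index p) (lookup-map (VecAny.index p) g xs)

module _ {n : ℕ} where

  Disjoint : Subset n → Subset n → Set
  Disjoint B C = ∀ {x} → x ∈ B → x ∈ C → ⊥

  record SameNonemptyBlocks (L M : List (Subset n)) : Set where
    field
      disjointˡ : AllPairs Disjoint L
      disjointʳ : AllPairs Disjoint M
      nonemptyˡ : ∀ {B} → B ∈ₗ L → Nonempty B → B ∈ₗ M
      nonemptyʳ : ∀ {C} → C ∈ₗ M → Nonempty C → C ∈ₗ L
  open SameNonemptyBlocks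

  same-blocks-sym : ∀ {L M} → SameNonemptyBlocks L M → SameNonemptyBlocks M L
  same-blocks-sym S = record
    { disjointˡ = disjointʳ S ; disjointʳ = disjointˡ S ; nonemptyˡ = nonemptyʳ S ; nonemptyʳ = nonemptyˡ S }

  disjoint-sym : ∀ {B C} → Disjoint B C → Disjoint C B
  disjoint-sym B∩C=∅ x∈C x∈B = B∩C=∅ x∈B x∈C

  disjoint-≢ : ∀ {B C} → Disjoint B C → Nonempty C → B ≢ C
  disjoint-≢ B∩C=∅ (x , x∈C) refl = B∩C=∅ x∈C x∈C

  peel : ∀ {B L M} → SameNonemptyBlocks (B ∷ L) M → Nonempty B →
         ∃ λ M′ → M ↭ B ∷ M′ × SameNonemptyBlocks L M′
  peel {B} {L} S neB with M₁ , M₂ , refl ← ∈-∃++ (nonemptyˡ S (here refl) neB) =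
    M₁ ++ M₂ , σ , record
      { disjointˡ = AllPairs.tail (disjointˡ S)
      ; disjointʳ = AllPairs.tail B∷M′-disjoint
      ; nonemptyˡ = λ B′∈L neB′ →
          in-M′ B′∈L neB′ (∈-resp-↭ σ (nonemptyˡ S (there B′∈L) neB′))
      ; nonemptyʳ = λ C∈M′ neC →
          in-L C∈M′ neC (nonemptyʳ S (∈-resp-↭ (↭-sym σ) (there C∈M′)) neC)
      }
    where
      σ : M₁ ++ B ∷ M₂ ↭ B ∷ M₁ ++ M₂
      σ = shift B M₁ M₂
      B∷M′-disjoint : AllPairs Disjoint (B ∷ M₁ ++ M₂)
      B∷M′-disjoint = AllPairs-resp-↭ disjoint-sym σ (disjointʳ S)
      in-M′ : ∀ {B′} → B′ ∈ₗ L → Nonempty B′ → B′ ∈ₗ B ∷ M₁ ++ M₂ → B′ ∈ₗ M₁ ++ M₂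
      in-M′ B′∈L neB′ (here B′≡B) =
        ⊥-elim (disjoint-≢ (All.lookup (AllPairs.head (disjointˡ S)) B′∈L) neB′ (≡.sym B′≡B))
      in-M′ B′∈L neB′ (there B′∈M′) = B′∈M′
      in-L : ∀ {C} → C ∈ₗ M₁ ++ M₂ → Nonempty C → C ∈ₗ B ∷ L → C ∈ₗ L
      in-L C∈M′ neC (here C≡B) =
        ⊥-elim (disjoint-≢ (All.lookup (AllPairs.head B∷M′-disjoint) C∈M′) neC (≡.sym C≡B))
      in-L C∈M′ neC (there C∈L) = C∈L

  drop-empty : ∀ {L M} → SameNonemptyBlocks (∅ ∷ L) (∅ ∷ M) → SameNonemptyBlocks L M
  drop-empty S = record
    { disjointˡ = AllPairs.tail (disjointˡ S)
    ; disjointʳ = AllPairs.tail (disjointʳ S)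
    ; nonemptyˡ = λ B∈L neB → skip-∅ neB (nonemptyˡ S (there B∈L) neB)
    ; nonemptyʳ = λ C∈M neC → skip-∅ neC (nonemptyʳ S (there C∈M) neC)
    }
    where
      skip-∅ : ∀ {B L} → Nonempty B → B ∈ₗ ∅ ∷ L → B ∈ₗ L
      skip-∅ (x , x∈∅) (here refl) = ⊥-elim (∉∅ x∈∅)
      skip-∅ _ (there B∈L) = B∈L

  same-nonempty-blocks-↭ : ∀ {L M} → length L ≡ length M → SameNonemptyBlocks L M → L ↭ M
  same-nonempty-blocks-↭ lL≡lM = go _ lL≡lM refl
    where
      shorter : ∀ {X x Y m} → X ↭ x ∷ Y → length X ≡ ℕ.suc m → length Y ≡ m
      shorter σ lX = ℕ-suc-injective (trans (≡.sym (↭-length σ)) lX)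

      go : ∀ m {L M} → length L ≡ m → length M ≡ m → SameNonemptyBlocks L M → L ↭ M
      go ℕ.zero {[]} {[]} _ _ _ = ↭-refl
      go (ℕ.suc m) {B ∷ L} {C ∷ M} lL lM S with nonempty? B | nonempty? C
      ... | yes neB | _ with M′ , σ , S′ ← peel S neB =
        ↭-trans (↭.prep B (go m (ℕ-suc-injective lL) (shorter σ lM) S′)) (↭-sym σ)
      ... | no _ | yes neC with L′ , τ , S′ ← peel (same-blocks-sym S) neC =
        ↭-sym (↭-trans (↭.prep C (go m (ℕ-suc-injective lM) (shorter τ lL) S′)) (↭-sym τ))
      ... | no ¬neB | no ¬neC with refl ← Empty-unique ¬neB | refl ← Empty-unique ¬neC =
        ↭.prep ∅ (go m (ℕ-suc-injective lL) (ℕ-suc-injective lM) (drop-empty S))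

  record Restriction (K : Fin n → Set) (g : Subset n → Subset n) : Set where
    field
      restrict⁺ : ∀ {x S} → K x → x ∈ S → x ∈ g S
      restrict⁻ : ∀ {x S} → x ∈ g S → K x × x ∈ S
  open Restriction public

  removal : ∀ v → Restriction (_≢ v) (removeV v)
  restrict⁺ (removal v) {x} {S} x≢v x∈S = []≔-minimal S x v x≢v x∈S
  restrict⁻ (removal v) {x} {S} x∈S-v =
    x≢v , lookup⇒[]= x S (trans (≡.sym (lookup∘update′ x≢v S outside)) ([]=⇒lookup x∈S-v))
    where
      x≢v : x ≢ v
      x≢v refl with () ← []=-injective x∈S-v ([]≔-updates S v)

  identity : Restriction (λ _ → ⊤) id
  restrict⁺ identity _ x∈S = x∈S
  restrict⁻ identity x∈S = tt , x∈S

-- Stable partitions and their difference edge sets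

does-true : ∀ {A : Set} (a? : Dec A) → does a? ≡ true → A
does-true (yes a) _ = a

module _ {n : ℕ} {G : Graph n} {k : ℕ} where

  block : StablePartition G k → Fin n → Fin k
  block P x = proj₁ (cover P x)

  blockOf : StablePartition G k → Fin n → Subset n
  blockOf P x = lookup (parts P) (block P x)

  ∈-blockOf : ∀ P x → x ∈ blockOf P x
  ∈-blockOf P x = proj₁ (proj₂ (cover P x))

  block-unique : ∀ P {x i} → x ∈ lookup (parts P) i → i ≡ block P x
  block-unique P {x} {i} x∈ = proj₂ (proj₂ (cover P x)) i x∈

  parts-disjoint : ∀ P {i j} → i ≢ j → Disjoint (lookup (parts P) i) (lookup (parts P) j)
  parts-disjoint P i≢j x∈i x∈j = i≢j (trans (block-unique P x∈i) (≡.sym (block-unique P x∈j)))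

  RefinesOn : (Fin n → Set) → StablePartition G k → StablePartition G k → Set
  RefinesOn K P Q = ∀ {s u} → K s → K u → block P s ≡ block P u → block Q s ≡ block Q u

  module _ {K : Fin n → Set} {g : Subset n → Subset n} (ρ : Restriction K g) where

    restricted-blocks : StablePartition G k → List (Subset n)
    restricted-blocks P = toList (map g (parts P))

    restricted-blocks-disjoint : ∀ P → AllPairs Disjoint (restricted-blocks P)
    restricted-blocks-disjoint P =
      AllPairs-toList⁺ (VecAllPairs.map⁺ (subst (VecAllPairs.AllPairs _) (tabulate∘lookup (parts P))
        (VecAllPairs.tabulate⁺ λ i≢j x∈i x∈j →
          parts-disjoint P i≢j (proj₂ (restrict⁻ ρ x∈i)) (proj₂ (restrict⁻ ρ x∈j)))))

    restricted-blockOf-⊆ : ∀ {P Q x} → RefinesOn K P Q → K x → g (blockOf P x) ⊆ g (blockOf Q x)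
    restricted-blockOf-⊆ {P} {Q} {x} P⊑Q Kx {y} y∈ with Ky , y∈P ← restrict⁻ ρ y∈ =
      restrict⁺ ρ Ky (subst (λ i → y ∈ lookup (parts Q) i)
                            (≡.sym (P⊑Q Kx Ky (block-unique P y∈P)))
                            (∈-blockOf Q y))

    nonempty-restricted-block : ∀ {P Q B} → RefinesOn K P Q → RefinesOn K Q P →
      B ∈ₗ restricted-blocks P → Nonempty B → B ∈ₗ restricted-blocks Q
    nonempty-restricted-block {P} {Q} P⊑Q Q⊑P B∈ (x , x∈B) with i , refl ← ∈-toList-map⁻ g B∈
      with Kx , x∈Pi ← restrict⁻ ρ x∈B
      with refl ← block-unique P x∈Pi =
      subst (_∈ₗ restricted-blocks Q)
            (⊆-antisym (restricted-blockOf-⊆ {Q} {P} Q⊑P Kx) (restricted-blockOf-⊆ {P} {Q} P⊑Q Kx))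
            (∈-toList-map⁺ g (parts Q) (block Q x))

    restricted-blocks-↭ : ∀ {P Q} → RefinesOn K P Q → RefinesOn K Q P →
                          restricted-blocks P ↭ restricted-blocks Q
    restricted-blocks-↭ {P} {Q} P⊑Q Q⊑P =
      same-nonempty-blocks-↭ (trans (length-toList (map g (parts P))) (≡.sym (length-toList (map g (parts Q)))))
      record
        { disjointˡ = restricted-blocks-disjoint P
        ; disjointʳ = restricted-blocks-disjoint Q
        ; nonemptyˡ = nonempty-restricted-block {P} {Q} P⊑Q Q⊑P
        ; nonemptyʳ = nonempty-restricted-block {Q} {P} Q⊑P P⊑Q
        }

  sameBlock : StablePartition G k → Fin n → Fin n → Bool
  sameBlock P s u = does (block P s ≟ block P u)

  sameBlock-sym : ∀ P s u → sameBlock P s u ≡ sameBlock P u s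
  sameBlock-sym P s u = does-⇔ (mk⇔ ≡.sym ≡.sym) (block P s ≟ block P u) (block P u ≟ block P s)

  diff : StablePartition G k → StablePartition G k → EdgeSet n
  EdgeSet.adj        (diff P Q) s u = sameBlock P s u xor sameBlock Q s u
  EdgeSet.adj-sym    (diff P Q) s u = cong₂ _xor_ (sameBlock-sym P s u) (sameBlock-sym Q s u)
  EdgeSet.adj-irrefl (diff P Q) s   =
    cong₂ _xor_ (dec-true (block P s ≟ block P s) refl) (dec-true (block Q s ≟ block Q s) refl)

  diff-⊕ : ∀ P Q R → diff P Q ⊕ diff P R ≈ diff Q R
  diff-⊕ P Q R = pointwise λ s u → xor-cancel (sameBlock P s u) (sameBlock Q s u) (sameBlock R s u)

  diff-⊕ʳ : ∀ P Q R → diff P R ⊕ diff Q R ≈ diff P Q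
  diff-⊕ʳ P Q R = pointwise λ s u → xor-cancelʳ (sameBlock P s u) (sameBlock Q s u) (sameBlock R s u)

  AgreeOn : (Fin n → Set) → StablePartition G k → StablePartition G k → Set
  AgreeOn K P Q = ∀ {s u} → K s → K u → sameBlock P s u ≡ sameBlock Q s u

  agree-sym : ∀ {K} P Q → AgreeOn K P Q → AgreeOn K Q P
  agree-sym P Q agree Ks Ku = ≡.sym (agree Ks Ku)

  agree⇒refines : ∀ {K} P Q → AgreeOn K P Q → RefinesOn K P Q
  agree⇒refines P Q agree {s} {u} Ks Ku Psu =
    does-true (block Q s ≟ block Q u) (trans (≡.sym (agree Ks Ku)) (dec-true (block P s ≟ block P u) Psu))

  refines⇒agree : ∀ {K} P Q → RefinesOn K P Q → RefinesOn K Q P → AgreeOn K P Q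
  refines⇒agree P Q P⊑Q Q⊑P {s} {u} Ks Ku =
    does-⇔ (mk⇔ (P⊑Q Ks Ku) (Q⊑P Ks Ku)) (block P s ≟ block P u) (block Q s ≟ block Q u)

  agree⇒blocks-↭ : ∀ {K g} (ρ : Restriction K g) P Q → AgreeOn K P Q →
                   restricted-blocks ρ P ↭ restricted-blocks ρ Q
  agree⇒blocks-↭ ρ P Q agree =
    restricted-blocks-↭ ρ {P} {Q} (agree⇒refines P Q agree) (agree⇒refines Q P (agree-sym P Q agree))

  star⇒agree : ∀ {v} P Q → Star v (diff P Q) → AgreeOn (_≢ v) P Q
  star⇒agree P Q (star off) s≢v u≢v = xor-false⁻ (off _ _ s≢v u≢v)

  agree⇒star : ∀ {v} P Q → AgreeOn (_≢ v) P Q → Star v (diff P Q)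
  agree⇒star P Q agree = star λ s u s≢v u≢v →
    trans (cong (_xor sameBlock Q s u) (agree s≢v u≢v)) (xor-same (sameBlock Q s u))

  common-part⇒same-block : ∀ Q {v j s u} → s ∈ removeV v (lookup (parts Q) j) →
                           u ∈ removeV v (lookup (parts Q) j) → block Q s ≡ block Q u
  common-part⇒same-block Q {v} s∈ u∈ = trans (≡.sym (block-unique Q (proj₂ (restrict⁻ (removal v) s∈))))
                                 (block-unique Q (proj₂ (restrict⁻ (removal v) u∈)))

  minus-↭⇒refines : ∀ {v} P Q → toList (P minus v) ↭ toList (Q minus v) → RefinesOn (_≢ v) P Q
  minus-↭⇒refines {v} P Q σ {s} {u} s≢v u≢v Psu
    with j , B≡ ← ∈-toList-map⁻ (removeV v)
                    (∈-resp-↭ σ (∈-toList-map⁺ (removeV v) (parts P) (block P s))) =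
    common-part⇒same-block Q (subst (s ∈_) B≡ s∈B) (subst (u ∈_) B≡ u∈B)
    where
      s∈B : s ∈ removeV v (blockOf P s)
      s∈B = restrict⁺ (removal v) s≢v (∈-blockOf P s)
      u∈B : u ∈ removeV v (blockOf P s)
      u∈B = restrict⁺ (removal v) u≢v (subst (λ i → u ∈ lookup (parts P) i) (≡.sym Psu) (∈-blockOf P u))

  star⇒minus-↭ : ∀ {v} P Q → Star v (diff P Q) → toList (P minus v) ↭ toList (Q minus v)
  star⇒minus-↭ {v} P Q st = agree⇒blocks-↭ (removal v) P Q (star⇒agree P Q st)

  edgeless⇒≈P : ∀ P Q → Edgeless (diff P Q) → P ≈P Q
  edgeless⇒≈P P Q edgeless =
    subst₂ _↭_ (cong toList (map-id (parts P))) (cong toList (map-id (parts Q)))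
      (agree⇒blocks-↭ identity P Q λ _ _ → xor-false⁻ (edgeless _ _))

  bell-adjacent⇒star : ∀ P Q → BellAdj G k P Q → IsStar (diff P Q)
  bell-adjacent⇒star P Q (_ , v , σ) =
    v , agree⇒star P Q (refines⇒agree P Q (minus-↭⇒refines P Q σ) (minus-↭⇒refines Q P (↭-sym σ)))

  non-adjacent⇒¬star : ∀ P Q → ¬ P ≈P Q → ¬ BellAdj G k P Q → ¬ IsStar (diff P Q)
  non-adjacent⇒¬star P Q P≉Q ¬adjacent (v , st) = ¬adjacent (P≉Q , v , star⇒minus-↭ P Q st)

  star-family : ∀ o (c : Fin 4 → StablePartition G k) → (∀ i → BellAdj G k o (c i)) →
                (∀ {i j} → i ≢ j → BellAdj G k (c i) (c j)) → StarFamily (λ i → diff o (c i))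
  star-family o c o~c c~c = record
    { member-star   = λ i → bell-adjacent⇒star o (c i) (o~c i)
    ; pair-star     = λ {i} {j} i≢j →
        isStar-resp (≈-sym (diff-⊕ o (c i) (c j))) (bell-adjacent⇒star (c i) (c j) (c~c i≢j))
    ; pair-nonempty = λ {i} {j} i≢j edgeless →
        proj₁ (c~c i≢j) (edgeless⇒≈P (c i) (c j) (edgeless-resp (diff-⊕ o (c i) (c j)) edgeless))
    }

no-induced-KminusE : ∀ m → 4 ≤ m → ∀ n (G : Graph n) k → ¬ KminusEInducedIn m G k
no-induced-KminusE m 4≤m n G k (f , injective , adjacency) = config-impossible config ¬star-ab
  where
    bell : ∀ {i j} → KminusE-Adj i j → BellAdj G k (f i) (f j)
    bell = proj₁ (adjacency _ _)

    J : Fin 4 → Fin (ℕ.suc (ℕ.suc m))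
    J i = suc (suc (inject≤ i 4≤m))

    c~c : ∀ {i j} → i ≢ j → BellAdj G k (f (J i)) (f (J j))
    c~c {i} {j} i≢j = bell ((i≢j ∘ inject≤-injective 4≤m 4≤m i j ∘ suc-injective ∘ suc-injective) ,
                            (λ { (() , _) }) , (λ { (() , _) }))

    config : Config (diff (f zero) (f (suc zero)))
    config = record
      { E        = λ i → diff (f zero) (f (J i))
      ; F        = λ i → diff (f (suc zero)) (f (J i))
      ; E-family = star-family (f zero) (f ∘ J)
                     (λ i → bell ((λ ()) , (λ { (_ , ()) }) , (λ { (() , _) }))) c~c
      ; F-family = star-family (f (suc zero)) (f ∘ J)
                     (λ i → bell ((λ ()) , (λ { (() , _) }) , (λ { (_ , ()) }))) c~c
      ; E⊕F≈D    = λ i → diff-⊕ʳ (f zero) (f (suc zero)) (f (J i))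
      }

    ¬star-ab : ¬ IsStar (diff (f zero) (f (suc zero)))
    ¬star-ab = non-adjacent⇒¬star (f zero) (f (suc zero)) (injective zero (suc zero) (λ ()))
                 (λ adjacent → proj₁ (proj₂ (proj₂ (adjacency zero (suc zero)) adjacent)) (refl , refl))

theorem3p10 : ((n : ℕ) (G : Graph n) (k : ℕ) → 1 ≤ k → ¬ KminusEInducedIn 4 G k)
    × ((m : ℕ) → 4 ≤ m → (n : ℕ) (G : Graph n) (k : ℕ) → 1 ≤ k → ¬ KminusEInducedIn m G k)
theorem3p10 = (λ n G k _ → no-induced-KminusE 4 ≤-refl n G k)
            , (λ m 4≤m n G k _ → no-induced-KminusE m 4≤m n G k)
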